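{- Let $\mathbf{u}_{TM}$ be the Thue-Morse word, let $R$ be the reversal mapping on $\{0,1\}^*$ and let $\Theta$ be the antimorphism on $\{0,1\}^*$ with $\Theta(0)=1$, $\Theta(1)=0$. Then for all $n\ge 1$, $$\Delta\mathcal{C}(n)+4=\mathcal{P}_{R}(n)+\mathcal{P}_{R}(n+1)+\mathcal{P}_{\Theta}(n)+\mathcal{P}_{\Theta}(n+1),$$ where all complexities are those of $\mathbf{u}_{TM}$.
   Context: The Thue-Morse word $\mathbf{u}_{TM}=0110100110010110\ldots$ is the fixed point $\lim_{n\to\infty}\varphi^n(0)$ of the morphism $\varphi(0)=01$, $\varphi(1)=10$. The reversal mapping is $R(w_1\cdots w_n)=w_n\cdots w_1$. An antimorphism satisfies $\Theta(vw)=\Theta(w)\Theta(v)$. $\mathcal{C}(n)$ is the number of distinct factors of length $n$ of $\mathbf{u}_{TM}$, $\Delta\mathcal{C}(n)=\mathcal{C}(n+1)-\mathcal{C}(n)$, and $\mathcal{P}_\Psi(n)$ is the number of factors $w$ of length $n$ with $\Psi(w)=w$. -}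

module Defs where

open import Data.Bool using (Bool; true; false; not)
open import Data.Nat using (ℕ; zero; suc; _+_)
open import Data.List using (List; []; _∷_; _++_; length; reverse; map; take; drop; lookup)
open import Data.List.Membership.Propositional using (_∈_)
open import Data.List.Relation.Unary.Unique.Propositional using (Unique)
open import Data.Product using (Σ; ∃; _×_; _,_)
open import Data.Fin using (Fin; fromℕ<)
open import Relation.Binary.PropositionalEquality using (_≡_; refl)
import Data.Nat.Properties as NP
open import Function.Bundles using (_⇔_)

-- Letters: false = 0, true = 1.  Words are lists of letters.
Word : Set
Word = List Bool

φ : Word → Word
φ [] = []
φ (a ∷ w) = a ∷ not a ∷ φ w

φ^ : ℕ → Word → Word
φ^ zero w = w
φ^ (suc k) w = φ (φ^ k w)

-- length of φ^k(0) is 2^k; we only need a (very crude) bound i < |φ^(i+1)(0)|.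
len-φ : ∀ w → length (φ w) ≡ length w + length w
len-φ [] = refl
len-φ (a ∷ w) rewrite len-φ w | NP.+-suc (length w) (length w) = refl

open import Data.Nat using (_<_; _≤_; s≤s; z≤n)

bound : ∀ i → i < length (φ^ (suc i) (false ∷ []))
bound zero = s≤s z≤n
bound (suc i) rewrite len-φ (φ^ (suc i) (false ∷ [])) =
  NP.≤-trans (NP.≤-reflexive (NP.+-comm 1 (suc i)))
    (NP.+-mono-≤ (bound i) (NP.≤-trans (s≤s z≤n) (bound i)))

-- u_TM = lim φ^n(0): its i-th letter is the i-th letter of the prefix φ^(i+1)(0).
uTM : ℕ → Bool
uTM i = lookup (φ^ (suc i) (false ∷ [])) (fromℕ< (bound i))

window : (ℕ → Bool) → ℕ → ℕ → Word
window u i zero = []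
window u i (suc n) = u i ∷ window u (suc i) n

Factor : Word → Set
Factor w = ∃ λ i → window uTM i (length w) ≡ w

R : Word → Word
R = reverse

Θ : Word → Word
Θ w = reverse (map not w)

IsCount : (Word → Set) → ℕ → Set
IsCount P k = Σ (List Word) λ ws → Unique ws × (∀ w → (w ∈ ws) ⇔ P w) × length ws ≡ k

IsC : ℕ → ℕ → Set
IsC n = IsCount (λ w → length w ≡ n × Factor w)

IsP : (Word → Word) → ℕ → ℕ → Set
IsP Ψ n = IsCount (λ w → length w ≡ n × Factor w × Ψ w ≡ w)

-- Every factor of u_TM of length 2k + 2 ≥ 6 is, according to the parity of its position, either
-- φ(v) for a factor v of length k + 1, or φ(u) stripped of both end letters for a factor u of
-- length k + 2; a factor of length 2k + 1 ≥ 5 is likewise φ(v) without its last or without its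
-- first letter, v a factor of length k + 1.  These maps are injective, and the two families are
-- disjoint because an overlap would force a cube aaa into a factor, and u_TM is cube-free.
-- Since R ∘ φ = φ ∘ Θ and Θ ∘ φ = φ ∘ R, the R-palindromes of length 2k + 2 correspond to the
-- Θ-palindromes of lengths k + 1 and k + 2 and vice versa, while for the same reason as before no
-- factor of odd length ≥ 5 is an R- or Θ-palindrome.  Under the resulting recurrences
-- C(2k+2) = C(k+1) + C(k+2), C(2k+1) = 2 C(k+1), P_R(2k+2) = P_Θ(k+1) + P_Θ(k+2), … the identity
-- at n ≥ 3 implies it at 2n − 1 and at 2n; for n ≤ 4 it is checked directly.

module Submission where

open import Defs
open import Level using (0ℓ)
open import Data.Bool using (Bool; true; false; not)
open import Data.Bool.Properties using (not-involutive; not-injective; not-¬)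
import Data.Bool.Properties as Bool
open import Data.Nat using (ℕ; zero; suc; _+_; _≤_; _<_; _≥_; s≤s; z≤n)
import Data.Nat as ℕ
open import Data.Nat.Properties using (+-comm; +-assoc; <⇒≤; <-trans; n<1+n; m≤n⇒m≤1+n; suc-injective)
open import Data.Nat.Induction using (<-rec)
open import Data.Nat.Tactic.RingSolver using (solve-∀)
open import Data.List using (List; []; _∷_; _++_; [_]; length; lookup; take; map; reverse; filter; tails; upTo)
open import Data.List.Properties
  using (∷-injectiveˡ; ∷-injectiveʳ; length-map; length-++; length-reverse;
         unfold-reverse; reverse-++; reverse-involutive; reverse-map; ≡-dec)
open import Data.List.Membership.Propositional using (_∈_)
open import Data.List.Membership.Propositional.Properties
  using (∈-map⁺; ∈-map⁻; ∈-++⁺ˡ; ∈-++⁺ʳ; ∈-++⁻; ∈-filter⁺; ∈-filter⁻)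
open import Data.List.Membership.Propositional.Properties.WithK using (unique∧set⇒bag)
open import Data.List.Relation.Binary.BagAndSetEquality using (∼bag⇒↭)
open import Data.List.Relation.Binary.Permutation.Propositional.Properties using (↭-length)
open import Data.List.Relation.Unary.All as All using (All; all?)
open import Data.List.Relation.Unary.AllPairs using ([])
open import Data.List.Relation.Unary.Any using (Any; here; there; any?; satisfied)
open import Data.List.Relation.Unary.Unique.Propositional using (Unique)
import Data.List.Relation.Unary.Unique.Propositional.Properties as Unique
open import Data.List.Relation.Unary.Unique.DecPropositional (≡-dec Bool._≟_) using (unique?)
open import Data.Fin using (fromℕ<)
open import Data.Product using (Σ; ∃; ∃₂; _×_; _,_; proj₁; proj₂) renaming (map to ×-map)
open import Data.Sum using (inj₁; inj₂)
open import Data.Empty using (⊥; ⊥-elim)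
open import Function using (_∘_)
open import Function.Bundles using (_⇔_; mk⇔; Equivalence)
open import Relation.Nullary using (Dec; yes; no; ¬_; ¬?)
open import Relation.Nullary.Decidable using (_×-dec_; True; toWitness)
open import Relation.Unary using (Pred; _⊆_; _∪_; _∩_; _≐_; Empty; Decidable)
open import Relation.Binary.Definitions using (DecidableEquality)
open import Relation.Binary.PropositionalEquality hiding ([_])

_≟ʷ_ : DecidableEquality Word
_≟ʷ_ = ≡-dec Bool._≟_

Image : (Word → Word) → Pred Word 0ℓ → Pred Word 0ℓ
Image f P w = ∃ λ v → P v × w ≡ f v

open Equivalence

IsCount-resp-≐ : ∀ {P Q k} → P ≐ Q → IsCount P k → IsCount Q k
IsCount-resp-≐ (P⊆Q , Q⊆P) (ws , unique , ∈⇔P , len) =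
  ws , unique , (λ w → mk⇔ (P⊆Q ∘ to (∈⇔P w)) (from (∈⇔P w) ∘ Q⊆P)) , len

IsCount-image : ∀ {P k} (f : Word → Word) → (∀ {x y} → f x ≡ f y → x ≡ y) →
                IsCount P k → IsCount (Image f P) k
IsCount-image {P} f f-injective (ws , unique , ∈⇔P , len) =
  map f ws , Unique.map⁺ f-injective unique , (λ w → mk⇔ image⁺ image⁻) , trans (length-map f ws) len
  where
  image⁺ : ∀ {w} → w ∈ map f ws → Image f P w
  image⁺ w∈ with ∈-map⁻ f w∈
  ... | v , v∈ , refl = v , to (∈⇔P v) v∈ , refl
  image⁻ : ∀ {w} → Image f P w → w ∈ map f ws
  image⁻ (v , Pv , refl) = ∈-map⁺ f (from (∈⇔P v) Pv)

IsCount-∪ : ∀ {P Q a b} → IsCount P a → IsCount Q b → (∀ {w} → P w → ¬ Q w) →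
            IsCount (P ∪ Q) (a + b)
IsCount-∪ {P} {Q} (ws , uniqueₚ , ∈⇔P , refl) (vs , unique₀ , ∈⇔Q , refl) disjoint =
  ws ++ vs ,
  Unique.++⁺ uniqueₚ unique₀ (λ (w∈ws , w∈vs) → disjoint (to (∈⇔P _) w∈ws) (to (∈⇔Q _) w∈vs)) ,
  (λ w → mk⇔ (union⁺ w) (union⁻ w)) , length-++ ws
  where
  union⁺ : ∀ w → w ∈ ws ++ vs → (P ∪ Q) w
  union⁺ w w∈ with ∈-++⁻ ws w∈
  ... | inj₁ w∈ws = inj₁ (to (∈⇔P w) w∈ws)
  ... | inj₂ w∈vs = inj₂ (to (∈⇔Q w) w∈vs)
  union⁻ : ∀ w → (P ∪ Q) w → w ∈ ws ++ vs
  union⁻ w (inj₁ Pw) = ∈-++⁺ˡ (from (∈⇔P w) Pw)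
  union⁻ w (inj₂ Qw) = ∈-++⁺ʳ ws (from (∈⇔Q w) Qw)

IsCount-∩ : ∀ {P Q k} (Q? : Decidable Q) (count : IsCount P k) →
            IsCount (P ∩ Q) (length (filter Q? (proj₁ count)))
IsCount-∩ {P} {Q} Q? (ws , unique , ∈⇔P , _) =
  filter Q? ws , Unique.filter⁺ Q? unique , (λ w → mk⇔ (∩⁺ w) (∩⁻ w)) , refl
  where
  ∩⁺ : ∀ w → w ∈ filter Q? ws → (P ∩ Q) w
  ∩⁺ w w∈ with ∈-filter⁻ Q? w∈
  ... | w∈ws , Qw = to (∈⇔P w) w∈ws , Qw
  ∩⁻ : ∀ w → (P ∩ Q) w → w ∈ filter Q? ws
  ∩⁻ w (Pw , Qw) = ∈-filter⁺ Q? (from (∈⇔P w) Pw) Qw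

IsCount-empty : ∀ {P} → Empty P → IsCount P 0
IsCount-empty empty = [] , [] , (λ w → mk⇔ (λ ()) (λ Pw → ⊥-elim (empty w Pw))) , refl

IsCount-unique : ∀ {P a b} → IsCount P a → IsCount P b → a ≡ b
IsCount-unique (ws , uniqueₚ , ∈⇔P , refl) (vs , unique₀ , ∈⇔P′ , refl) =
  ↭-length (∼bag⇒↭ (unique∧set⇒bag uniqueₚ unique₀ same-members))
  where
  same-members : ∀ {w} → w ∈ ws ⇔ w ∈ vs
  same-members {w} = mk⇔ (from (∈⇔P′ w) ∘ to (∈⇔P w)) (from (∈⇔P w) ∘ to (∈⇔P′ w))

double : ℕ → ℕ
double zero = zero
double (suc n) = suc (suc (double n))

data Parity : ℕ → Set where
  even : ∀ j → Parity (double j)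
  odd  : ∀ j → Parity (suc (double j))

parity : ∀ n → Parity n
parity zero = even zero
parity (suc n) with parity n
... | even j = odd j
... | odd j = even (suc j)

suc-double-< : ∀ {j n} → j < n → suc (double j) < double n
suc-double-< {zero} {suc n} _ = s≤s (s≤s z≤n)
suc-double-< {suc j} {suc n} (s≤s j<n) = s≤s (s≤s (suc-double-< j<n))

length-φ : ∀ w → length (φ w) ≡ double (length w)
length-φ [] = refl
length-φ (a ∷ w) = cong (λ n → suc (suc n)) (length-φ w)

φ-++ : ∀ xs ys → φ (xs ++ ys) ≡ φ xs ++ φ ys
φ-++ [] ys = refl
φ-++ (a ∷ xs) ys = cong (λ w → a ∷ not a ∷ w) (φ-++ xs ys)

φ^-++ : ∀ k xs ys → φ^ k (xs ++ ys) ≡ φ^ k xs ++ φ^ k ys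
φ^-++ zero xs ys = refl
φ^-++ (suc k) xs ys = trans (cong φ (φ^-++ k xs ys)) (φ-++ (φ^ k xs) (φ^ k ys))

φ^-+ : ∀ k d w → φ^ (k + d) w ≡ φ^ k (φ^ d w)
φ^-+ zero d w = refl
φ^-+ (suc k) d w = cong φ (φ^-+ k d w)

prefix : ℕ → Word
prefix k = φ^ k (false ∷ [])

φ^-starts-with-0 : ∀ d → ∃ λ s → φ^ d (false ∷ []) ≡ false ∷ s
φ^-starts-with-0 zero = [] , refl
φ^-starts-with-0 (suc d) with φ^-starts-with-0 d
... | s , e = true ∷ φ s , cong φ e

prefix-extends : ∀ k d → ∃ λ s → prefix (k + d) ≡ prefix k ++ s
prefix-extends k d with φ^-starts-with-0 d
... | s , e = φ^ k s , (begin
  φ^ (k + d) (false ∷ [])       ≡⟨ φ^-+ k d _ ⟩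
  φ^ k (φ^ d (false ∷ []))       ≡⟨ cong (φ^ k) e ⟩
  φ^ k ((false ∷ []) ++ s)       ≡⟨ φ^-++ k (false ∷ []) s ⟩
  prefix k ++ φ^ k s             ∎)
  where open ≡-Reasoning

nth : Word → ℕ → Bool
nth [] _ = false
nth (a ∷ w) zero = a
nth (a ∷ w) (suc i) = nth w i

lookup≡nth : ∀ xs {i} (p : i < length xs) → lookup xs (fromℕ< p) ≡ nth xs i
lookup≡nth (x ∷ xs) {zero} p = refl
lookup≡nth (x ∷ xs) {suc i} (s≤s p) = lookup≡nth xs p

nth-++ˡ : ∀ xs ys {i} → i < length xs → nth (xs ++ ys) i ≡ nth xs i
nth-++ˡ (x ∷ xs) ys {zero} _ = refl
nth-++ˡ (x ∷ xs) ys {suc i} (s≤s p) = nth-++ˡ xs ys p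

nth-prefix-+ : ∀ k d {i} → i < length (prefix k) → nth (prefix (k + d)) i ≡ nth (prefix k) i
nth-prefix-+ k d p with prefix-extends k d
... | s , e = trans (cong (λ w → nth w _) e) (nth-++ˡ (prefix k) s p)

uTM≡nth-prefix : ∀ k {i} → i < length (prefix k) → uTM i ≡ nth (prefix k) i
uTM≡nth-prefix k {i} p = begin
  uTM i                            ≡⟨ lookup≡nth (prefix (suc i)) (bound i) ⟩
  nth (prefix (suc i)) i           ≡⟨ sym (nth-prefix-+ (suc i) k (bound i)) ⟩
  nth (prefix (suc i + k)) i       ≡⟨ cong (λ n → nth (prefix n) i) (+-comm (suc i) k) ⟩
  nth (prefix (k + suc i)) i       ≡⟨ nth-prefix-+ k (suc i) p ⟩
  nth (prefix k) i                 ∎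
  where open ≡-Reasoning

nth-φ-double : ∀ w j → nth (φ w) (double j) ≡ nth w j
nth-φ-double [] j = refl
nth-φ-double (a ∷ w) zero = refl
nth-φ-double (a ∷ w) (suc j) = nth-φ-double w j

nth-φ-suc-double : ∀ w {j} → j < length w → nth (φ w) (suc (double j)) ≡ not (nth w j)
nth-φ-suc-double (a ∷ w) {zero} _ = refl
nth-φ-suc-double (a ∷ w) {suc j} (s≤s p) = nth-φ-suc-double w p

suc-double-<-length-prefix : ∀ j → suc (double j) < length (prefix (2 + j))
suc-double-<-length-prefix j =
  subst (suc (double j) <_) (sym (length-φ (prefix (suc j)))) (suc-double-< (bound j))

uTM-double : ∀ j → uTM (double j) ≡ uTM j
uTM-double j = begin
  uTM (double j)                        ≡⟨ uTM≡nth-prefix (2 + j) (<⇒≤ (suc-double-<-length-prefix j)) ⟩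
  nth (φ (prefix (suc j))) (double j)   ≡⟨ nth-φ-double (prefix (suc j)) j ⟩
  nth (prefix (suc j)) j                ≡⟨ sym (uTM≡nth-prefix (suc j) (bound j)) ⟩
  uTM j                                 ∎
  where open ≡-Reasoning

uTM-suc-double : ∀ j → uTM (suc (double j)) ≡ not (uTM j)
uTM-suc-double j = begin
  uTM (suc (double j))                        ≡⟨ uTM≡nth-prefix (2 + j) (suc-double-<-length-prefix j) ⟩
  nth (φ (prefix (suc j))) (suc (double j))   ≡⟨ nth-φ-suc-double (prefix (suc j)) (bound j) ⟩
  not (nth (prefix (suc j)) j)                ≡⟨ cong not (sym (uTM≡nth-prefix (suc j) (bound j))) ⟩
  not (uTM j)                                 ∎
  where open ≡-Reasoning

uTM-pair-distinct : ∀ j → uTM (double j) ≢ uTM (suc (double j))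
uTM-pair-distinct j e = not-¬ refl (trans (sym (uTM-double j)) (trans e (uTM-suc-double j)))

no-three-equal : ∀ i → uTM i ≡ uTM (suc i) → uTM (suc i) ≡ uTM (2 + i) → ⊥
no-three-equal i with parity i
... | even j = λ e _ → uTM-pair-distinct j e
... | odd j = λ _ e → uTM-pair-distinct (suc j) e

CubePrefix : Word → Set
CubePrefix w = ∃₂ λ a t → w ≡ a ∷ a ∷ a ∷ t

cube-free : ∀ {w} → Factor w → CubePrefix w → ⊥
cube-free (i , e) (a , t , refl) = no-three-equal i (trans x₀ (sym x₁)) (trans x₁ (sym x₂))
  where
  x₀ : uTM i ≡ a
  x₀ = ∷-injectiveˡ e
  x₁ : uTM (suc i) ≡ a
  x₁ = ∷-injectiveˡ (∷-injectiveʳ e)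
  x₂ : uTM (2 + i) ≡ a
  x₂ = ∷-injectiveˡ (∷-injectiveʳ (∷-injectiveʳ e))

-- φ v without its last letter, without its first letter, and without both; innerφ is only
-- meaningful for |v| ≥ 2.
initφ : Word → Word
initφ [] = []
initφ (a ∷ []) = a ∷ []
initφ (a ∷ b ∷ w) = a ∷ not a ∷ initφ (b ∷ w)

tailφ : Word → Word
tailφ [] = []
tailφ (a ∷ w) = not a ∷ φ w

innerφ : Word → Word
innerφ [] = []
innerφ (a ∷ w) = not a ∷ initφ w

cubes-from-letters : ∀ {a b c d e f} →
  a ∷ not a ∷ b ∷ not b ∷ c ∷ [] ≡ not d ∷ e ∷ not e ∷ f ∷ not f ∷ [] →
  (a ≡ b × b ≡ c) × (d ≡ e × e ≡ f)
cubes-from-letters {d = false} refl = (refl , refl) , (refl , refl)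
cubes-from-letters {d = true} refl = (refl , refl) , (refl , refl)

cube-prefix : ∀ {a b c t} → a ≡ b × b ≡ c → CubePrefix (a ∷ b ∷ c ∷ t)
cube-prefix (refl , refl) = _ , _ , refl

initφ≡tailφ⇒cubes : ∀ {v u m n} → length v ≡ 3 + m → length u ≡ 3 + n →
                    initφ v ≡ tailφ u → CubePrefix v × CubePrefix u
initφ≡tailφ⇒cubes {a ∷ b ∷ c ∷ t} {d ∷ e ∷ f ∷ s} _ _ eq =
  ×-map cube-prefix cube-prefix (cubes-from-letters (trans (sym (take-5 t)) (cong (take 5) eq)))
  where
  take-5 : ∀ t → take 5 (initφ (a ∷ b ∷ c ∷ t)) ≡ a ∷ not a ∷ b ∷ not b ∷ c ∷ []
  take-5 [] = refl
  take-5 (_ ∷ _) = refl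

φ-injective : ∀ {x y} → φ x ≡ φ y → x ≡ y
φ-injective {[]} {[]} _ = refl
φ-injective {a ∷ x} {b ∷ y} eq =
  cong₂ _∷_ (∷-injectiveˡ eq) (φ-injective (∷-injectiveʳ (∷-injectiveʳ eq)))

initφ-injective : ∀ {x y} → initφ x ≡ initφ y → x ≡ y
initφ-injective {[]} {[]} _ = refl
initφ-injective {a ∷ []} {b ∷ []} refl = refl
initφ-injective {a ∷ a′ ∷ x} {b ∷ b′ ∷ y} eq =
  cong₂ _∷_ (∷-injectiveˡ eq) (initφ-injective (∷-injectiveʳ (∷-injectiveʳ eq)))
initφ-injective {[]} {_ ∷ []} ()
initφ-injective {[]} {_ ∷ _ ∷ _} ()
initφ-injective {_ ∷ []} {[]} ()
initφ-injective {_ ∷ _ ∷ _} {[]} ()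
initφ-injective {_ ∷ []} {_ ∷ _ ∷ _} ()
initφ-injective {_ ∷ _ ∷ _} {_ ∷ []} ()

tailφ-injective : ∀ {x y} → tailφ x ≡ tailφ y → x ≡ y
tailφ-injective {[]} {[]} _ = refl
tailφ-injective {a ∷ x} {b ∷ y} eq =
  cong₂ _∷_ (not-injective (∷-injectiveˡ eq)) (φ-injective (∷-injectiveʳ eq))

innerφ-injective : ∀ {x y} → innerφ x ≡ innerφ y → x ≡ y
innerφ-injective {[]} {[]} _ = refl
innerφ-injective {a ∷ x} {b ∷ y} eq =
  cong₂ _∷_ (not-injective (∷-injectiveˡ eq)) (initφ-injective (∷-injectiveʳ eq))

window-φ : ∀ j m → window uTM (double j) (double m) ≡ φ (window uTM j m)
window-φ j zero = refl
window-φ j (suc m) =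
  cong₂ _∷_ (uTM-double j) (cong₂ _∷_ (uTM-suc-double j) (window-φ (suc j) m))

window-initφ : ∀ j k → window uTM (double j) (suc (double k)) ≡ initφ (window uTM j (suc k))
window-initφ j zero = cong (_∷ []) (uTM-double j)
window-initφ j (suc k) =
  cong₂ _∷_ (uTM-double j) (cong₂ _∷_ (uTM-suc-double j) (window-initφ (suc j) k))

window-tailφ : ∀ j k → window uTM (suc (double j)) (suc (double k)) ≡ tailφ (window uTM j (suc k))
window-tailφ j k = cong₂ _∷_ (uTM-suc-double j) (window-φ (suc j) k)

window-innerφ : ∀ j k → window uTM (suc (double j)) (double (suc k)) ≡ innerφ (window uTM j (2 + k))
window-innerφ j k = cong₂ _∷_ (uTM-suc-double j) (window-initφ (suc j) k)

FactorOfLength : ℕ → Word → Set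
FactorOfLength n w = length w ≡ n × Factor w

length-window : ∀ u i n → length (window u i n) ≡ n
length-window u i zero = refl
length-window u i (suc n) = cong suc (length-window u (suc i) n)

window-factor : ∀ i n → FactorOfLength n (window uTM i n)
window-factor i n = length-window uTM i n , i , cong (window uTM i) (length-window uTM i n)

factor-window : ∀ {n w} → FactorOfLength n w → ∃ λ i → window uTM i n ≡ w
factor-window (refl , occurrence) = occurrence

φ-factor : ∀ {m v} → FactorOfLength m v → FactorOfLength (double m) (φ v)
φ-factor {m} f with factor-window f
... | j , refl = subst (FactorOfLength _) (window-φ j m) (window-factor (double j) (double m))

initφ-factor : ∀ {m v} → FactorOfLength (suc m) v → FactorOfLength (suc (double m)) (initφ v)
initφ-factor {m} f with factor-window f
... | j , refl = subst (FactorOfLength _) (window-initφ j m) (window-factor (double j) _)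

tailφ-factor : ∀ {m v} → FactorOfLength (suc m) v → FactorOfLength (suc (double m)) (tailφ v)
tailφ-factor {m} f with factor-window f
... | j , refl = subst (FactorOfLength _) (window-tailφ j m) (window-factor (suc (double j)) _)

innerφ-factor : ∀ {k u} → FactorOfLength (2 + k) u → FactorOfLength (double (suc k)) (innerφ u)
innerφ-factor {k} f with factor-window f
... | j , refl = subst (FactorOfLength _) (window-innerφ j k) (window-factor (suc (double j)) _)

even-factors : ∀ {k} → Image φ (FactorOfLength (suc k)) ∪ Image innerφ (FactorOfLength (2 + k))
                      ≐ FactorOfLength (double (suc k))
even-factors {k} = join , split
  where
  join : Image φ (FactorOfLength (suc k)) ∪ Image innerφ (FactorOfLength (2 + k))
         ⊆ FactorOfLength (double (suc k))
  join (inj₁ (_ , fv , refl)) = φ-factor fv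
  join (inj₂ (_ , fu , refl)) = innerφ-factor fu
  split : FactorOfLength (double (suc k))
          ⊆ Image φ (FactorOfLength (suc k)) ∪ Image innerφ (FactorOfLength (2 + k))
  split f with factor-window f
  ... | i , refl with parity i
  ... | even j = inj₁ (_ , window-factor j (suc k) , window-φ j (suc k))
  ... | odd j = inj₂ (_ , window-factor j (2 + k) , window-innerφ j k)

odd-factors : ∀ {m} → Image initφ (FactorOfLength (suc m)) ∪ Image tailφ (FactorOfLength (suc m))
                     ≐ FactorOfLength (suc (double m))
odd-factors {m} = join , split
  where
  join : Image initφ (FactorOfLength (suc m)) ∪ Image tailφ (FactorOfLength (suc m))
         ⊆ FactorOfLength (suc (double m))
  join (inj₁ (_ , fv , refl)) = initφ-factor fv
  join (inj₂ (_ , fu , refl)) = tailφ-factor fu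
  split : FactorOfLength (suc (double m))
          ⊆ Image initφ (FactorOfLength (suc m)) ∪ Image tailφ (FactorOfLength (suc m))
  split f with factor-window f
  ... | i , refl with parity i
  ... | even j = inj₁ (_ , window-factor j (suc m) , window-initφ j m)
  ... | odd j = inj₂ (_ , window-factor j (suc m) , window-tailφ j m)

-- Dropping the first letter of both sides turns φ v ≡ innerφ (x ∷ u) into tailφ v ≡ initφ u.
φ-innerφ-disjoint : ∀ {k v u} → FactorOfLength (3 + k) v → FactorOfLength (4 + k) u → φ v ≢ innerφ u
φ-innerφ-disjoint {v = a ∷ v} {x ∷ u} (lv , fv) (lu , _) eq =
  cube-free fv (proj₂ (initφ≡tailφ⇒cubes (suc-injective lu) lv (sym (∷-injectiveʳ eq))))

initφ-tailφ-disjoint : ∀ {m v u} → FactorOfLength (3 + m) v → FactorOfLength (3 + m) u →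
                       initφ v ≢ tailφ u
initφ-tailφ-disjoint (lv , fv) (lu , _) eq = cube-free fv (proj₁ (initφ≡tailφ⇒cubes lv lu eq))

Θ-∷ : ∀ a w → Θ (a ∷ w) ≡ Θ w ++ [ not a ]
Θ-∷ a w = unfold-reverse (not a) (map not w)

map-not-involutive : ∀ w → map not (map not w) ≡ w
map-not-involutive [] = refl
map-not-involutive (a ∷ w) = cong₂ _∷_ (not-involutive a) (map-not-involutive w)

Θ-involutive : ∀ w → Θ (Θ w) ≡ w
Θ-involutive w = begin
  reverse (map not (reverse (map not w)))  ≡⟨ cong reverse (reverse-map not (map not w)) ⟩
  reverse (reverse (map not (map not w)))  ≡⟨ reverse-involutive _ ⟩
  map not (map not w)                      ≡⟨ map-not-involutive w ⟩
  w                                        ∎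
  where open ≡-Reasoning

initφ-snoc : ∀ v b → initφ (v ++ [ b ]) ≡ φ v ++ [ b ]
initφ-snoc [] b = refl
initφ-snoc (a ∷ []) b = refl
initφ-snoc (a ∷ c ∷ v) b = cong (λ w → a ∷ not a ∷ w) (initφ-snoc (c ∷ v) b)

innerφ-snoc : ∀ v a b → innerφ ((v ++ [ a ]) ++ [ b ]) ≡ tailφ (v ++ [ a ]) ++ [ b ]
innerφ-snoc [] a b = refl
innerφ-snoc (c ∷ v) a b = cong (not c ∷_) (initφ-snoc (v ++ [ a ]) b)

reverse-φ : ∀ v → reverse (φ v) ≡ φ (Θ v)
reverse-φ [] = refl
reverse-φ (a ∷ v) = begin
  reverse ((a ∷ not a ∷ []) ++ φ v)     ≡⟨ reverse-++ (a ∷ not a ∷ []) (φ v) ⟩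
  reverse (φ v) ++ not a ∷ a ∷ []       ≡⟨ cong₂ _++_ (reverse-φ v) (cong (λ b → not a ∷ b ∷ []) a≡not-not-a) ⟩
  φ (Θ v) ++ φ [ not a ]                ≡⟨ sym (φ-++ (Θ v) [ not a ]) ⟩
  φ (Θ v ++ [ not a ])                  ≡⟨ cong φ (sym (Θ-∷ a v)) ⟩
  φ (Θ (a ∷ v))                         ∎
  where
  open ≡-Reasoning
  a≡not-not-a : a ≡ not (not a)
  a≡not-not-a = sym (not-involutive a)

reverse-tailφ : ∀ u → reverse (tailφ u) ≡ initφ (Θ u)
reverse-tailφ [] = refl
reverse-tailφ (a ∷ v) = begin
  reverse (not a ∷ φ v)       ≡⟨ unfold-reverse (not a) (φ v) ⟩
  reverse (φ v) ++ [ not a ]  ≡⟨ cong (_++ [ not a ]) (reverse-φ v) ⟩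
  φ (Θ v) ++ [ not a ]        ≡⟨ sym (initφ-snoc (Θ v) (not a)) ⟩
  initφ (Θ v ++ [ not a ])    ≡⟨ cong initφ (sym (Θ-∷ a v)) ⟩
  initφ (Θ (a ∷ v))           ∎
  where open ≡-Reasoning

reverse-initφ : ∀ u → reverse (initφ u) ≡ tailφ (Θ u)
reverse-initφ u = begin
  reverse (initφ u)                    ≡⟨ cong (reverse ∘ initφ) (sym (Θ-involutive u)) ⟩
  reverse (initφ (Θ (Θ u)))            ≡⟨ cong reverse (sym (reverse-tailφ (Θ u))) ⟩
  reverse (reverse (tailφ (Θ u)))      ≡⟨ reverse-involutive _ ⟩
  tailφ (Θ u)                          ∎
  where open ≡-Reasoning

reverse-innerφ : ∀ x y u → reverse (innerφ (x ∷ y ∷ u)) ≡ innerφ (Θ (x ∷ y ∷ u))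
reverse-innerφ x y u = begin
  reverse (not x ∷ initφ (y ∷ u))              ≡⟨ unfold-reverse (not x) (initφ (y ∷ u)) ⟩
  reverse (initφ (y ∷ u)) ++ [ not x ]         ≡⟨ cong (_++ [ not x ]) (reverse-initφ (y ∷ u)) ⟩
  tailφ (Θ (y ∷ u)) ++ [ not x ]               ≡⟨ cong (λ w → tailφ w ++ [ not x ]) (Θ-∷ y u) ⟩
  tailφ (Θ u ++ [ not y ]) ++ [ not x ]        ≡⟨ sym (innerφ-snoc (Θ u) (not y) (not x)) ⟩
  innerφ ((Θ u ++ [ not y ]) ++ [ not x ])     ≡⟨ cong (λ w → innerφ (w ++ [ not x ])) (sym (Θ-∷ y u)) ⟩
  innerφ (Θ (y ∷ u) ++ [ not x ])              ≡⟨ cong innerφ (sym (Θ-∷ x (y ∷ u))) ⟩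
  innerφ (Θ (x ∷ y ∷ u))                       ∎
  where open ≡-Reasoning

map-not-φ : ∀ v → map not (φ v) ≡ φ (map not v)
map-not-φ [] = refl
map-not-φ (a ∷ v) = cong (λ w → not a ∷ not (not a) ∷ w) (map-not-φ v)

map-not-initφ : ∀ v → map not (initφ v) ≡ initφ (map not v)
map-not-initφ [] = refl
map-not-initφ (a ∷ []) = refl
map-not-initφ (a ∷ b ∷ v) = cong (λ w → not a ∷ not (not a) ∷ w) (map-not-initφ (b ∷ v))

map-not-tailφ : ∀ v → map not (tailφ v) ≡ tailφ (map not v)
map-not-tailφ [] = refl
map-not-tailφ (a ∷ v) = cong (not (not a) ∷_) (map-not-φ v)

map-not-innerφ : ∀ v → map not (innerφ v) ≡ innerφ (map not v)
map-not-innerφ [] = refl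
map-not-innerφ (a ∷ v) = cong (not (not a) ∷_) (map-not-initφ v)

Θ-from-reverse : ∀ {F G : Word → Word} v → map not (F v) ≡ F (map not v) →
                 reverse (F (map not v)) ≡ G (Θ (map not v)) → Θ (F v) ≡ G (R v)
Θ-from-reverse {F} {G} v F-not reverse-F = begin
  reverse (map not (F v))   ≡⟨ cong reverse F-not ⟩
  reverse (F (map not v))   ≡⟨ reverse-F ⟩
  G (Θ (map not v))         ≡⟨ cong (G ∘ reverse) (map-not-involutive v) ⟩
  G (reverse v)             ∎
  where open ≡-Reasoning

Θ-φ : ∀ v → Θ (φ v) ≡ φ (R v)
Θ-φ v = Θ-from-reverse {φ} {φ} v (map-not-φ v) (reverse-φ (map not v))

Θ-initφ : ∀ u → Θ (initφ u) ≡ tailφ (R u)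
Θ-initφ u = Θ-from-reverse {initφ} {tailφ} u (map-not-initφ u) (reverse-initφ (map not u))

Θ-tailφ : ∀ u → Θ (tailφ u) ≡ initφ (R u)
Θ-tailφ u = Θ-from-reverse {tailφ} {initφ} u (map-not-tailφ u) (reverse-tailφ (map not u))

Θ-innerφ : ∀ x y u → Θ (innerφ (x ∷ y ∷ u)) ≡ innerφ (R (x ∷ y ∷ u))
Θ-innerφ x y u = Θ-from-reverse {innerφ} {innerφ} (x ∷ y ∷ u)
  (map-not-innerφ (x ∷ y ∷ u)) (reverse-innerφ (not x) (not y) (map not u))

IsC-even : ∀ {k a b} → IsC (3 + k) a → IsC (4 + k) b → IsC (double (3 + k)) (a + b)
IsC-even ca cb = IsCount-resp-≐ even-factors
  (IsCount-∪ (IsCount-image φ φ-injective ca) (IsCount-image innerφ innerφ-injective cb) disjoint)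
  where
  disjoint : ∀ {w} → Image φ _ w → ¬ Image innerφ _ w
  disjoint (_ , fv , refl) (_ , fu , eq) = φ-innerφ-disjoint fv fu eq

IsC-odd : ∀ {m b} → IsC (3 + m) b → IsC (suc (double (2 + m))) (b + b)
IsC-odd cb = IsCount-resp-≐ odd-factors
  (IsCount-∪ (IsCount-image initφ initφ-injective cb) (IsCount-image tailφ tailφ-injective cb) disjoint)
  where
  disjoint : ∀ {w} → Image initφ _ w → ¬ Image tailφ _ w
  disjoint (_ , fv , refl) (_ , fu , eq) = initφ-tailφ-disjoint fv fu eq

FixedFactor : (Word → Word) → ℕ → Word → Set
FixedFactor Ψ n w = length w ≡ n × Factor w × Ψ w ≡ w

IsP-even : ∀ {Ψ Ψ′ : Word → Word} {k a b} →
           (∀ v → Ψ (φ v) ≡ φ (Ψ′ v)) →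
           (∀ x y u → Ψ (innerφ (x ∷ y ∷ u)) ≡ innerφ (Ψ′ (x ∷ y ∷ u))) →
           IsP Ψ′ (3 + k) a → IsP Ψ′ (4 + k) b → IsP Ψ (double (3 + k)) (a + b)
IsP-even {Ψ} {Ψ′} {k} Ψ-φ Ψ-innerφ ca cb = IsCount-resp-≐ (join , split)
  (IsCount-∪ (IsCount-image φ φ-injective ca) (IsCount-image innerφ innerφ-injective cb) disjoint)
  where
  join : Image φ (FixedFactor Ψ′ (3 + k)) ∪ Image innerφ (FixedFactor Ψ′ (4 + k))
         ⊆ FixedFactor Ψ (double (3 + k))
  join (inj₁ (v , (lv , fv , fixed) , refl)) =
    let l , f = φ-factor (lv , fv) in l , f , trans (Ψ-φ v) (cong φ fixed)
  join (inj₂ (x ∷ y ∷ u , (lu , fu , fixed) , refl)) =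
    let l , f = innerφ-factor (lu , fu) in l , f , trans (Ψ-innerφ x y u) (cong innerφ fixed)
  split : FixedFactor Ψ (double (3 + k))
          ⊆ Image φ (FixedFactor Ψ′ (3 + k)) ∪ Image innerφ (FixedFactor Ψ′ (4 + k))
  split (l , f , fixed) with proj₂ even-factors (l , f)
  ... | inj₁ (v , (lv , fv) , refl) =
    inj₁ (v , (lv , fv , φ-injective (trans (sym (Ψ-φ v)) fixed)) , refl)
  ... | inj₂ (x ∷ y ∷ u , (lu , fu) , refl) =
    inj₂ (_ , (lu , fu , innerφ-injective (trans (sym (Ψ-innerφ x y u)) fixed)) , refl)
  disjoint : ∀ {w} → Image φ (FixedFactor Ψ′ (3 + k)) w → ¬ Image innerφ (FixedFactor Ψ′ (4 + k)) w
  disjoint (_ , (lv , fv , _) , refl) (_ , (lu , fu , _) , eq) = φ-innerφ-disjoint (lv , fv) (lu , fu) eq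

IsP-odd : ∀ {Ψ Ψ′ : Word → Word} {m} →
          (∀ u → Ψ (initφ u) ≡ tailφ (Ψ′ u)) → (∀ u → Ψ (tailφ u) ≡ initφ (Ψ′ u)) →
          (∀ u → length (Ψ′ u) ≡ length u) → IsP Ψ (suc (double (2 + m))) 0
IsP-odd {Ψ} {Ψ′} {m} Ψ-initφ Ψ-tailφ length-Ψ′ = IsCount-empty no-fixed-point
  where
  no-fixed-point : Empty (FixedFactor Ψ (suc (double (2 + m))))
  no-fixed-point w (l , f , fixed) with proj₂ (odd-factors {2 + m}) (l , f)
  ... | inj₁ (u , (lu , fu) , refl) =
    cube-free fu (proj₁ (initφ≡tailφ⇒cubes lu (trans (length-Ψ′ u) lu) (trans (sym fixed) (Ψ-initφ u))))
  ... | inj₂ (u , (lu , fu) , refl) =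
    cube-free fu (proj₂ (initφ≡tailφ⇒cubes (trans (length-Ψ′ u) lu) lu (trans (sym (Ψ-tailφ u)) fixed)))

words : ℕ → List Word
words zero = [] ∷ []
words (suc n) = map (false ∷_) (words n) ++ map (true ∷_) (words n)

∈-words : ∀ w → w ∈ words (length w)
∈-words [] = here refl
∈-words (false ∷ w) = ∈-++⁺ˡ (∈-map⁺ (false ∷_) (∈-words w))
∈-words (true ∷ w) = ∈-++⁺ʳ _ (∈-map⁺ (true ∷_) (∈-words w))

cube-prefix? : Decidable CubePrefix
cube-prefix? (a ∷ b ∷ c ∷ t) with a Bool.≟ b | b Bool.≟ c
... | yes refl | yes refl = yes (a , t , refl)
... | no a≢b | _ = no λ { (_ , _ , refl) → a≢b refl }
... | yes _ | no b≢c = no λ { (_ , _ , refl) → b≢c refl }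
cube-prefix? [] = no λ { (_ , _ , ()) }
cube-prefix? (_ ∷ []) = no λ { (_ , _ , ()) }
cube-prefix? (_ ∷ _ ∷ []) = no λ { (_ , _ , ()) }

factor-tail : ∀ {a w} → Factor (a ∷ w) → Factor w
factor-tail (i , e) = suc i , ∷-injectiveʳ e

factor-avoids-cubes : ∀ {w} → Factor w → ¬ Any CubePrefix (tails w)
factor-avoids-cubes f (here c) = cube-free f c
factor-avoids-cubes {_ ∷ _} f (there c) = factor-avoids-cubes (factor-tail f) c

-- Up to length 4 the factors are exactly the words without a cube; that each of them occurs
-- in u_TM is checked by finding it among the first 16 letters.
cube-free-words : ℕ → List Word
cube-free-words n = filter (λ w → ¬? (any? cube-prefix? (tails w))) (words n)

OccursEarly : Word → Set
OccursEarly w = Any (λ i → window uTM i (length w) ≡ w) (upTo 16)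

occurs-early? : Decidable OccursEarly
occurs-early? w = any? (λ i → window uTM i (length w) ≟ʷ w) (upTo 16)

IsC-small : ∀ n → All (λ w → length w ≡ n × OccursEarly w) (cube-free-words n) →
            Unique (cube-free-words n) →
            IsC n (length (cube-free-words n))
IsC-small n early unique = cube-free-words n , unique , (λ w → mk⇔ (sound w) (complete w)) , refl
  where
  sound : ∀ w → w ∈ cube-free-words n → FactorOfLength n w
  sound w w∈ with All.lookup early w∈
  ... | l , occ = l , satisfied occ
  complete : ∀ w → FactorOfLength n w → w ∈ cube-free-words n
  complete w (refl , f) = ∈-filter⁺ _ (∈-words w) (factor-avoids-cubes f)

cube-free-words-occur? : ∀ n → Dec (All (λ w → length w ≡ n × OccursEarly w) (cube-free-words n))
cube-free-words-occur? n = all? (λ w → (length w ℕ.≟ n) ×-dec occurs-early? w) (cube-free-words n)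

IsP-filter : ∀ {n k} Ψ → (count : IsC n k) → IsP Ψ n (length (filter (λ w → Ψ w ≟ʷ w) (proj₁ count)))
IsP-filter Ψ count = IsCount-resp-≐
  ((λ ((l , f) , fixed) → l , f , fixed) , (λ (l , f , fixed) → (l , f) , fixed))
  (IsCount-∩ (λ w → Ψ w ≟ʷ w) count)

record Complexities (n : ℕ) : Set where
  field
    c r t : ℕ
    factors : IsC n c
    R-palindromes : IsP R n r
    Θ-palindromes : IsP Θ n t

open Complexities

counts : ∀ {n} → Complexities n → ℕ × ℕ × ℕ
counts x = c x , r x , t x

complexities-unique : ∀ {n} (x y : Complexities n) → counts x ≡ counts y
complexities-unique x y =
  cong₂ _,_ (IsCount-unique (factors x) (factors y))
            (cong₂ _,_ (IsCount-unique (R-palindromes x) (R-palindromes y))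
                       (IsCount-unique (Θ-palindromes x) (Θ-palindromes y)))

complexities-from-IsC : ∀ {n c} → IsC n c → Complexities n
complexities-from-IsC count = record
  { factors = count ; R-palindromes = IsP-filter R count ; Θ-palindromes = IsP-filter Θ count }

small-complexities : ∀ n → {True (cube-free-words-occur? n)} → {True (unique? (cube-free-words n))} →
                     Complexities n
small-complexities n {early} {unique} = complexities-from-IsC (IsC-small n (toWitness early) (toWitness unique))

length-Θ : ∀ w → length (Θ w) ≡ length w
length-Θ w = trans (length-reverse (map not w)) (length-map not w)

even-complexities : ∀ {k} → Complexities (3 + k) → Complexities (4 + k) → Complexities (double (3 + k))
even-complexities x y = record
  { c = c x + c y ; r = t x + t y ; t = r x + r y
  ; factors = IsC-even (factors x) (factors y)
  ; R-palindromes = IsP-even reverse-φ reverse-innerφ (Θ-palindromes x) (Θ-palindromes y)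
  ; Θ-palindromes = IsP-even Θ-φ Θ-innerφ (R-palindromes x) (R-palindromes y)
  }

odd-complexities : ∀ {m} → Complexities (3 + m) → Complexities (suc (double (2 + m)))
odd-complexities x = record
  { c = c x + c x ; r = 0 ; t = 0
  ; factors = IsC-odd (factors x)
  ; R-palindromes = IsP-odd reverse-initφ reverse-tailφ length-Θ
  ; Θ-palindromes = IsP-odd Θ-initφ Θ-tailφ length-reverse
  }

n≤double : ∀ n → n ≤ double n
n≤double zero = z≤n
n≤double (suc n) = s≤s (m≤n⇒m≤1+n (n≤double n))

n+1<2n : ∀ k → 4 + k < double (3 + k)
n+1<2n k = s≤s (s≤s (s≤s (s≤s (s≤s (m≤n⇒m≤1+n (n≤double k))))))

n<2n-1 : ∀ m → 3 + m < suc (double (2 + m))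
n<2n-1 m = s≤s (s≤s (s≤s (s≤s (m≤n⇒m≤1+n (n≤double m)))))

complexities : ∀ n → n ≥ 1 → Complexities n
complexities = <-rec (λ n → n ≥ 1 → Complexities n) go
  where
  go : ∀ n → (∀ {m} → m < n → m ≥ 1 → Complexities m) → n ≥ 1 → Complexities n
  go n rec n≥1 with parity n
  go _ rec () | even 0
  ... | even 1 = small-complexities 2
  ... | even 2 = small-complexities 4
  ... | even (suc (suc (suc k))) =
    even-complexities (rec (<-trans (n<1+n _) (n+1<2n k)) (s≤s z≤n)) (rec (n+1<2n k) (s≤s z≤n))
  ... | odd 0 = small-complexities 1
  ... | odd 1 = small-complexities 3
  ... | odd (suc (suc m)) = odd-complexities (rec (n<2n-1 m) (s≤s z≤n))

Balanced : ℕ × ℕ × ℕ → ℕ × ℕ × ℕ → Set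
Balanced (c₀ , r₀ , t₀) (c₁ , r₁ , t₁) = c₁ + 4 ≡ c₀ + (r₀ + r₁ + t₀ + t₁)

balanced-even : ∀ {k} (x : Complexities (3 + k)) (y : Complexities (4 + k)) → Balanced (counts x) (counts y) →
                Balanced (counts (even-complexities x y)) (counts (odd-complexities y))
balanced-even x y balanced = begin
  c y + c y + 4                                         ≡⟨ +-assoc (c y) (c y) 4 ⟩
  c y + (c y + 4)                                       ≡⟨ cong (c y +_) balanced ⟩
  c y + (c x + (r x + r y + t x + t y))                 ≡⟨ rearrange (c x) (r x) (t x) (c y) (r y) (t y) ⟩
  c x + c y + (t x + t y + 0 + (r x + r y) + 0)         ∎
  where
  open ≡-Reasoning
  rearrange : ∀ c₀ r₀ t₀ c₁ r₁ t₁ →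
              c₁ + (c₀ + (r₀ + r₁ + t₀ + t₁)) ≡ c₀ + c₁ + (t₀ + t₁ + 0 + (r₀ + r₁) + 0)
  rearrange = solve-∀

balanced-odd : ∀ {m} (x : Complexities (3 + m)) (y : Complexities (4 + m)) → Balanced (counts x) (counts y) →
               Balanced (counts (odd-complexities x)) (counts (even-complexities x y))
balanced-odd x y balanced = begin
  c x + c y + 4                                         ≡⟨ +-assoc (c x) (c y) 4 ⟩
  c x + (c y + 4)                                       ≡⟨ cong (c x +_) balanced ⟩
  c x + (c x + (r x + r y + t x + t y))                 ≡⟨ rearrange (c x) (r x) (t x) (r y) (t y) ⟩
  c x + c x + (0 + (t x + t y) + 0 + (r x + r y))       ∎
  where
  open ≡-Reasoning
  rearrange : ∀ c₀ r₀ t₀ r₁ t₁ →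
              c₀ + (c₀ + (r₀ + r₁ + t₀ + t₁)) ≡ c₀ + c₀ + (0 + (t₀ + t₁) + 0 + (r₀ + r₁))
  rearrange = solve-∀

BalancedAt : ℕ → Set
BalancedAt n = ∀ (x : Complexities n) (y : Complexities (suc n)) → Balanced (counts x) (counts y)

balanced-by-uniqueness : ∀ {n} (x′ : Complexities n) (y′ : Complexities (suc n)) →
                         Balanced (counts x′) (counts y′) → BalancedAt n
balanced-by-uniqueness x′ y′ balanced x y =
  subst₂ Balanced (complexities-unique x′ x) (complexities-unique y′ y) balanced

balanced : ∀ n → n ≥ 1 → BalancedAt n
balanced = <-rec (λ n → n ≥ 1 → BalancedAt n) go
  where
  go : ∀ n → (∀ {m} → m < n → m ≥ 1 → BalancedAt m) → n ≥ 1 → BalancedAt n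
  go n rec n≥1 with parity n
  go _ rec () | even 0
  ... | even 1 = balanced-by-uniqueness (small-complexities 2) (small-complexities 3) refl
  ... | even 2 = balanced-by-uniqueness (small-complexities 4) (odd-complexities (small-complexities 3)) refl
  ... | even (suc (suc (suc k))) = balanced-by-uniqueness (even-complexities x y) (odd-complexities y)
          (balanced-even x y (rec (<-trans (n<1+n _) (n+1<2n k)) (s≤s z≤n) x y))
    where
    x : Complexities (3 + k)
    x = complexities (3 + k) (s≤s z≤n)
    y : Complexities (4 + k)
    y = complexities (4 + k) (s≤s z≤n)
  ... | odd 0 = balanced-by-uniqueness (small-complexities 1) (small-complexities 2) refl
  ... | odd 1 = balanced-by-uniqueness (small-complexities 3) (small-complexities 4) refl
  ... | odd (suc (suc m)) = balanced-by-uniqueness (odd-complexities x) (even-complexities x y)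
          (balanced-odd x y (rec (n<2n-1 m) (s≤s z≤n) x y))
    where
    x : Complexities (3 + m)
    x = complexities (3 + m) (s≤s z≤n)
    y : Complexities (4 + m)
    y = complexities (4 + m) (s≤s z≤n)

corollary5 : ∀ (n : ℕ) → n ≥ 1 →
    Σ ℕ λ c₀ → Σ ℕ λ c₁ → Σ ℕ λ r₀ → Σ ℕ λ r₁ → Σ ℕ λ t₀ → Σ ℕ λ t₁ →
    IsC n c₀ × IsC (suc n) c₁ ×
    IsP R n r₀ × IsP R (suc n) r₁ ×
    IsP Θ n t₀ × IsP Θ (suc n) t₁ ×
    c₁ + 4 ≡ c₀ + (r₀ + r₁ + t₀ + t₁)
corollary5 n n≥1 =
  c x , c y , r x , r y , t x , t y ,
  factors x , factors y , R-palindromes x , R-palindromes y , Θ-palindromes x , Θ-palindromes y ,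
  balanced n n≥1 x y
  where
  x : Complexities n
  x = complexities n n≥1
  y : Complexities (suc n)
  y = complexities (suc n) (s≤s z≤n)
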